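{- Let $G^\varphi$ be a connected quaternion unit gain graph whose underlying graph is bipartite, and let $r$ be the rank of its adjacency matrix. Then $r=2$ if and only if the underlying graph is complete bipartite and every $4$-cycle of $G^\varphi$ has gain $1$.
   Context: $U(\mathbb{H})$ is the group of unit quaternions, with conjugation $q\mapsto q^*$. A quaternion unit gain graph $G^\varphi=(G,\varphi)$ is a simple graph $G$ on vertices $v_1,\dots,v_n$ together with a function $\varphi$ assigning to each oriented edge $e_{jk}$ a unit quaternion with $\varphi(e_{jk})=\varphi(e_{kj})^*$. Its adjacency matrix is the Hermitian matrix $A=(\ell_{jk})$ with $\ell_{jk}=\varphi(e_{jk})$ if $v_jv_k$ is an edge and $0$ otherwise. The rank of a quaternion matrix $A\in\mathbb{H}^{m\times n}$ is the minimal $r$ such that $A=BC$ with $B\in\mathbb{H}^{m\times r}$, $C\in\mathbb{H}^{r\times n}$. The gain of a walk $v_0v_1\cdots v_m$ is the ordered product $\varphi(e_{v_0v_1})\varphi(e_{v_1v_2})\cdots\varphi(e_{v_{m-1}v_m})$; a cycle has gain $1$ if the gain of the closed walk around it equals $1$ (this property does not depend on the starting vertex or direction). -}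

module Defs where

open import Data.Nat using (ℕ; zero; suc) renaming (_<_ to _<ℕ_)
open import Data.Fin using (Fin; zero; suc)
open import Data.Bool using (Bool; true; false; if_then_else_)
open import Data.Product using (Σ; ∃; ∃-syntax; _×_; _,_)
open import Data.Sum using (_⊎_)
open import Data.List using (List; []; _∷_)
open import Relation.Nullary using (¬_)
open import Relation.Binary.PropositionalEquality using (_≡_; _≢_)

-- The real numbers, given axiomatically as a complete ordered field
-- (this axiom system characterises ℝ up to isomorphism).

record Reals : Set₁ where
  infixl 6 _+_
  infixl 7 _*_
  infix 4 _<ℝ_ _≤ℝ_
  field
    R    : Set
    0ℝ 1ℝ : R
    _+_ _*_ : R → R → R
    -_   : R → R
    _<ℝ_  : R → R → Set
    +-assoc : ∀ x y z → (x + y) + z ≡ x + (y + z)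
    +-comm  : ∀ x y → x + y ≡ y + x
    +-identityˡ : ∀ x → 0ℝ + x ≡ x
    +-inverseˡ  : ∀ x → (- x) + x ≡ 0ℝ
    *-assoc : ∀ x y z → (x * y) * z ≡ x * (y * z)
    *-comm  : ∀ x y → x * y ≡ y * x
    *-identityˡ : ∀ x → 1ℝ * x ≡ x
    distribˡ : ∀ x y z → x * (y + z) ≡ x * y + x * z
    0≢1 : 0ℝ ≢ 1ℝ
    *-inverse : ∀ x → x ≢ 0ℝ → ∃[ y ] (x * y ≡ 1ℝ)
    <-irrefl : ∀ x → ¬ (x <ℝ x)
    <-trans  : ∀ {x y z} → x <ℝ y → y <ℝ z → x <ℝ z
    <-trichotomy : ∀ x y → x <ℝ y ⊎ x ≡ y ⊎ y <ℝ x
    +-mono-< : ∀ {x y} z → x <ℝ y → x + z <ℝ y + z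
    *-pos    : ∀ {x y} → 0ℝ <ℝ x → 0ℝ <ℝ y → 0ℝ <ℝ x * y
  _≤ℝ_ : R → R → Set
  x ≤ℝ y = x <ℝ y ⊎ x ≡ y
  field
    completeness : (P : R → Set) → ∃[ x ] P x → ∃[ b ] (∀ x → P x → x ≤ℝ b) →
                   ∃[ s ] ((∀ x → P x → x ≤ℝ s) × (∀ b → (∀ x → P x → x ≤ℝ b) → s ≤ℝ b))

module Quaternions (ℝ : Reals) where
  open Reals ℝ

  record ℍ : Set where
    constructor quat
    field re i j k : R

  open ℍ public

  0ℍ 1ℍ : ℍ
  0ℍ = quat 0ℝ 0ℝ 0ℝ 0ℝ
  1ℍ = quat 1ℝ 0ℝ 0ℝ 0ℝ

  infixl 6 _-ℝ_ _+ℍ_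
  infixl 7 _*ℍ_

  _-ℝ_ : R → R → R
  x -ℝ y = x + (- y)

  _+ℍ_ : ℍ → ℍ → ℍ
  quat a b c d +ℍ quat a' b' c' d' = quat (a + a') (b + b') (c + c') (d + d')

  _*ℍ_ : ℍ → ℍ → ℍ
  quat a₁ b₁ c₁ d₁ *ℍ quat a₂ b₂ c₂ d₂ =
    quat (a₁ * a₂ -ℝ b₁ * b₂ -ℝ c₁ * c₂ -ℝ d₁ * d₂)
         (a₁ * b₂ + b₁ * a₂ + c₁ * d₂ -ℝ d₁ * c₂)
         (a₁ * c₂ -ℝ b₁ * d₂ + c₁ * a₂ + d₁ * b₂)
         (a₁ * d₂ + b₁ * c₂ -ℝ c₁ * b₂ + d₁ * a₂)

  conj : ℍ → ℍ
  conj (quat a b c d) = quat a (- b) (- c) (- d)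

  normSq : ℍ → R
  normSq (quat a b c d) = a * a + b * b + c * c + d * d

  IsUnit : ℍ → Set
  IsUnit q = normSq q ≡ 1ℝ

  sumℍ : ∀ {r} → (Fin r → ℍ) → ℍ
  sumℍ {zero}  f = 0ℍ
  sumℍ {suc r} f = f zero +ℍ sumℍ (λ i → f (suc i))

  Matrix : ℕ → ℕ → Set
  Matrix m n = Fin m → Fin n → ℍ

  HasFactorization : ∀ {m n} → Matrix m n → ℕ → Set
  HasFactorization {m} {n} A r =
    Σ (Matrix m r) λ B → Σ (Matrix r n) λ C →
      ∀ j k → A j k ≡ sumℍ (λ i → B j i *ℍ C i k)

  IsRank : ∀ {m n} → Matrix m n → ℕ → Set
  IsRank A r = HasFactorization A r × (∀ s → s <ℕ r → ¬ HasFactorization A s)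

  record GainGraph (n : ℕ) : Set where
    field
      E   : Fin n → Fin n → Bool
      irrefl : ∀ v → E v v ≡ false
      sym : ∀ u v → E u v ≡ E v u
      φ   : Fin n → Fin n → ℍ
      φ-unit : ∀ u v → E u v ≡ true → IsUnit (φ u v)
      φ-conj : ∀ u v → E u v ≡ true → φ u v ≡ conj (φ v u)

  module _ {n : ℕ} (Γ : GainGraph n) where
    open GainGraph Γ

    adjMatrix : Matrix n n
    adjMatrix u v = if E u v then φ u v else 0ℍ

    data Walk : Fin n → Fin n → Set where
      here : ∀ {u} → Walk u u
      step : ∀ {u w v} → E u w ≡ true → Walk w v → Walk u v

    Connected : Set
    Connected = ∀ u v → Walk u v

    Bipartite : Set
    Bipartite = Σ (Fin n → Bool) λ c → ∀ u v → E u v ≡ true → c u ≢ c v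

    CompleteBipartite : Set
    CompleteBipartite =
      Σ (Fin n → Bool) λ c →
        (∃[ u ] c u ≡ true) × (∃[ u ] c u ≡ false) ×
        (∀ u v → (E u v ≡ true → c u ≢ c v) × (c u ≢ c v → E u v ≡ true))

    Is4Cycle : Fin n → Fin n → Fin n → Fin n → Set
    Is4Cycle a b c d =
      (a ≢ b) × (a ≢ c) × (a ≢ d) × (b ≢ c) × (b ≢ d) × (c ≢ d) ×
      (E a b ≡ true) × (E b c ≡ true) × (E c d ≡ true) × (E d a ≡ true)

    gain4 : Fin n → Fin n → Fin n → Fin n → ℍ
    gain4 a b c d = ((φ a b *ℍ φ b c) *ℍ φ c d) *ℍ φ d a

    All4CyclesGainOne : Set
    All4CyclesGainOne = ∀ a b c d → Is4Cycle a b c d → gain4 a b c d ≡ 1ℍ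

{-# OPTIONS --safe #-}

-- Colour the vertices so that A = [[0 , X] , [X* , 0]]. Since ℍ is a division ring, Gaussian
-- elimination shows that any three rows of a matrix factoring through ℍ² are left linearly
-- dependent. Two rows a, c of one colour together with a row b adjacent to a are three such
-- rows, and only b meets column a, so rows a and c alone are dependent: κ₀ A a k + κ₁ A c k = 0
-- for all k. For a path a b c d, the columns d and b force a and d to be adjacent; shortening odd
-- walks by this closure shows that a connected such graph is complete bipartite. For a 4-cycle
-- a b c d the same two columns give κ₀ · gain = κ₀ with κ₀ ≠ 0, so the gain is 1.
-- Conversely, fixing an edge u₀ w₀, the gain condition gives φ j k = φ j w₀ φ w₀ u₀ φ u₀ k for
-- j, k of colours true, false, which writes A as an (n × 2)(2 × n) product; rank one is excluded
-- because A u₀ u₀ = 0 while A u₀ w₀ and A w₀ u₀ are nonzero.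

module Submission where

open import Defs
open import Data.Nat using (ℕ)
open import Data.Product using (_×_)
open import Function.Bundles using (_⇔_)

open import Algebra.Bundles using (RawRing; Ring; CommutativeRing)
open import Algebra.Consequences.Propositional
  using (comm∧idˡ⇒id; comm∧invˡ⇒inv; comm∧distrˡ⇒distr; comm∧assoc⇒middleFour)
import Algebra.Properties.Ring as RingProperties
open import Algebra.Solver.Ring.AlmostCommutativeRing using (_-Raw-AlmostCommutative⟶_; fromCommutativeRing)
open import Data.Bool.Base using (Bool; true; false; not; if_then_else_)
open import Data.Bool.Properties using (¬-not) renaming (_≟_ to _≟ᴮ_)
open import Data.Fin.Base using (Fin; zero; suc; fromℕ; _↑ʳ_; punchIn; punchOut)
open import Data.Fin.Properties using (all?; any?; ¬∀⟶∃¬; punchIn-punchOut) renaming (_≟_ to _≟ᶠ_)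
open import Data.Maybe.Base as Maybe using (Maybe)
open import Data.Nat.Base as ℕ using (zero; suc; _∸_; s≤s; z≤n) renaming (_<_ to _<ℕ_)
import Data.Nat.Properties as ℕ
open import Data.Product.Base using (_,_; Σ-syntax; ∃; ∃₂; proj₁; proj₂; swap)
open import Data.Product.Properties using (≡-dec)
open import Data.Sum.Base using (inj₁; inj₂)
open import Function.Base using (_∘_)
open import Function.Bundles using (mk⇔)
open import Level using (0ℓ; _⊔_)
open import Relation.Binary.Definitions using (DecidableEquality)
open import Relation.Binary.PropositionalEquality
  using (_≡_; _≢_; refl; sym; trans; cong; cong₂; subst; subst₂; isEquivalence; module ≡-Reasoning)
open import Relation.Nullary using (¬_; Dec; yes; no; contradiction)
open import Relation.Nullary.Decidable.Core using (dec⇒maybe)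

module LeftLinearDependence {c ℓ} (R : Ring c ℓ) where

  open Ring R hiding (zero; refl) renaming (sym to ≈-sym; trans to ≈-trans)
  open import Algebra.Properties.Semiring.Sum semiring
    using (sum; sum-cong-≋; sum-replicate-zero; ∑-distrib-+; ∑-comm; *-distribˡ-sum; *-distribʳ-sum)
  open import Relation.Binary.Reasoning.Setoid setoid
  open import Data.Vec.Functional using (_∷_)

  LeftDependent : ∀ {m d} → (Fin m → Fin d → Carrier) → Set (c ⊔ ℓ)
  LeftDependent {m} v =
    Σ[ a ∈ (Fin m → Carrier) ] ¬ (∀ i → a i ≈ 0#) × (∀ t → sum (λ i → a i * v i t) ≈ 0#)

  sum-≈0 : ∀ {m} {xs : Fin m → Carrier} → (∀ i → xs i ≈ 0#) → sum xs ≈ 0#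
  sum-≈0 {m} xs≈0 = ≈-trans (sum-cong-≋ xs≈0) (sum-replicate-zero m)

  sum-*-+-* : ∀ {m} (a x b : Fin m → Carrier) y →
              sum (λ i → a i * (x i + b i * y)) ≈ sum (λ i → a i * x i) + sum (λ i → a i * b i) * y
  sum-*-+-* a x b y = begin
    sum (λ i → a i * (x i + b i * y))             ≈⟨ sum-cong-≋ (λ i → ≈-trans (distribˡ (a i) (x i) (b i * y))
                                                                        (+-congˡ (≈-sym (*-assoc (a i) (b i) y)))) ⟩
    sum (λ i → a i * x i + (a i * b i) * y)       ≈⟨ ∑-distrib-+ (λ i → a i * x i) (λ i → (a i * b i) * y) ⟩
    sum (λ i → a i * x i) + sum (λ i → (a i * b i) * y) ≈⟨ +-congˡ (*-distribʳ-sum y (λ i → a i * b i)) ⟨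
    sum (λ i → a i * x i) + sum (λ i → a i * b i) * y   ∎

  factor-LeftDependent : ∀ {m d q} {u : Fin m → Fin q → Carrier} (v : Fin m → Fin d → Carrier) (C : Fin d → Fin q → Carrier) →
                         (∀ i k → u i k ≈ sum (λ t → v i t * C t k)) → LeftDependent v → LeftDependent u
  factor-LeftDependent {u = u} v C u≈vC (a , a≉0 , av≈0) = a , a≉0 , λ k → begin
    sum (λ i → a i * u i k)                               ≈⟨ sum-cong-≋ (λ i → *-congˡ (u≈vC i k)) ⟩
    sum (λ i → a i * sum (λ t → v i t * C t k))           ≈⟨ sum-cong-≋ (λ i → *-distribˡ-sum (a i) (λ t → v i t * C t k)) ⟩
    sum (λ i → sum (λ t → a i * (v i t * C t k)))         ≈⟨ sum-cong-≋ (λ i → sum-cong-≋ (λ t → ≈-sym (*-assoc (a i) (v i t) (C t k)))) ⟩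
    sum (λ i → sum (λ t → (a i * v i t) * C t k))         ≈⟨ ∑-comm (λ i t → (a i * v i t) * C t k) ⟩
    sum (λ t → sum (λ i → (a i * v i t) * C t k))         ≈⟨ sum-cong-≋ (λ t → *-distribʳ-sum (C t k) (λ i → a i * v i t)) ⟨
    sum (λ t → sum (λ i → a i * v i t) * C t k)           ≈⟨ sum-≈0 (λ t → ≈-trans (*-congʳ (av≈0 t)) (zeroˡ (C t k))) ⟩
    0#                                                    ∎

  -- Clears coordinate p of the vectors v (suc i) when y is a left inverse of the pivot v zero p.
  eliminate : ∀ {m d} (v : Fin (suc m) → Fin d → Carrier) (p : Fin d) (y : Carrier) → Fin m → Fin d → Carrier
  eliminate v p y i t = v (suc i) t + (- v (suc i) p * y) * v zero t

  eliminate-pivot : ∀ {m d} (v : Fin (suc m) → Fin d → Carrier) {p y} → y * v zero p ≈ 1# →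
                    ∀ i → eliminate v p y i p ≈ 0#
  eliminate-pivot v {p} {y} yv₀ₚ≈1 i = begin
    v (suc i) p + (- v (suc i) p * y) * v zero p  ≈⟨ +-congˡ (*-assoc (- v (suc i) p) y (v zero p)) ⟩
    v (suc i) p + - v (suc i) p * (y * v zero p)  ≈⟨ +-congˡ (*-congˡ yv₀ₚ≈1) ⟩
    v (suc i) p + - v (suc i) p * 1#              ≈⟨ +-congˡ (*-identityʳ (- v (suc i) p)) ⟩
    v (suc i) p + - v (suc i) p                   ≈⟨ -‿inverseʳ (v (suc i) p) ⟩
    0#                                            ∎

  LeftDependent-eliminate : ∀ {m d} (v : Fin (suc m) → Fin (suc d) → Carrier) {p y} → y * v zero p ≈ 1# →
                            LeftDependent (λ i s → eliminate v p y i (punchIn p s)) → LeftDependent v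
  LeftDependent-eliminate {m} v {p} {y} yv₀ₚ≈1 (a , a≉0 , a·reduced≈0) =
    (sum (λ i → a i * b i) ∷ a) , (λ a′≈0 → a≉0 (a′≈0 ∘ suc)) , vanishes
    where
    b : Fin m → Carrier
    b i = - v (suc i) p * y

    combination : ∀ t → sum (λ i → (sum (λ i → a i * b i) ∷ a) i * v i t) ≈ sum (λ i → a i * eliminate v p y i t)
    combination t = begin
      sum (λ i → a i * b i) * v zero t + sum (λ i → a i * v (suc i) t)
        ≈⟨ +-comm _ _ ⟩
      sum (λ i → a i * v (suc i) t) + sum (λ i → a i * b i) * v zero t
        ≈⟨ sum-*-+-* a (λ i → v (suc i) t) b (v zero t) ⟨
      sum (λ i → a i * eliminate v p y i t) ∎

    vanishes : ∀ t → sum (λ i → (sum (λ i → a i * b i) ∷ a) i * v i t) ≈ 0#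
    vanishes t with p ≟ᶠ t
    ... | yes refl = ≈-trans (combination p)
                       (sum-≈0 (λ i → ≈-trans (*-congˡ (eliminate-pivot v yv₀ₚ≈1 i)) (zeroʳ (a i))))
    ... | no p≢t   = ≈-trans (combination t)
                       (subst (λ t → sum (λ i → a i * eliminate v p y i t) ≈ 0#)
                              (punchIn-punchOut p≢t) (a·reduced≈0 (punchOut p≢t)))

  module DivisionRing
    (_≟0 : ∀ x → Dec (x ≈ 0#))
    (left-inverse : ∀ {x} → ¬ x ≈ 0# → ∃ λ y → y * x ≈ 1#)
    (1≉0 : ¬ 1# ≈ 0#)
    where

    *-cancelˡ : ∀ {x y z} → ¬ x ≈ 0# → x * y ≈ x * z → y ≈ z
    *-cancelˡ {x} {y} {z} x≉0 xy≈xz with left-inverse x≉0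
    ... | x⁻¹ , x⁻¹x≈1 = begin
      y               ≈⟨ *-identityˡ y ⟨
      1# * y          ≈⟨ *-congʳ x⁻¹x≈1 ⟨
      (x⁻¹ * x) * y   ≈⟨ *-assoc x⁻¹ x y ⟩
      x⁻¹ * (x * y)   ≈⟨ *-congˡ xy≈xz ⟩
      x⁻¹ * (x * z)   ≈⟨ *-assoc x⁻¹ x z ⟨
      (x⁻¹ * x) * z   ≈⟨ *-congʳ x⁻¹x≈1 ⟩
      1# * z          ≈⟨ *-identityˡ z ⟩
      z               ∎

    *≈0⇒≈0 : ∀ {x y} → ¬ x ≈ 0# → x * y ≈ 0# → y ≈ 0#
    *≈0⇒≈0 {x} x≉0 xy≈0 = *-cancelˡ x≉0 (≈-trans xy≈0 (≈-sym (zeroʳ x)))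

    ¬inner-dimension-one : ∀ {p} {A : Fin p → Fin p → Carrier} {u w} →
                           A u u ≈ 0# → ¬ A u w ≈ 0# → ¬ A w u ≈ 0# →
                           ∀ (B : Fin p → Fin 1 → Carrier) (C : Fin 1 → Fin p → Carrier) → ¬ (∀ j k → A j k ≈ sum (λ t → B j t * C t k))
    ¬inner-dimension-one {A = A} {u} {w} Auu≈0 Auw≉0 Awu≉0 B C A≈BC = Awu≉0 (begin
      A w u                          ≈⟨ A≈BC w u ⟩
      B w zero * C zero u + 0#       ≈⟨ +-identityʳ _ ⟩
      B w zero * C zero u            ≈⟨ *-congˡ Cu≈0 ⟩
      B w zero * 0#                  ≈⟨ zeroʳ _ ⟩
      0#                             ∎)
      where
      Bu≉0 : ¬ B u zero ≈ 0#
      Bu≉0 Bu≈0 = Auw≉0 (≈-trans (A≈BC u w) (≈-trans (+-identityʳ _) (≈-trans (*-congʳ Bu≈0) (zeroˡ _))))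
      Cu≈0 : C zero u ≈ 0#
      Cu≈0 = *≈0⇒≈0 Bu≉0 (≈-trans (≈-sym (+-identityʳ _)) (≈-trans (≈-sym (A≈BC u u)) Auu≈0))

    more-vectors-than-coordinates⇒dependent : ∀ {d} (v : Fin (suc d) → Fin d → Carrier) → LeftDependent v
    more-vectors-than-coordinates⇒dependent {zero} v = (λ _ → 1#) , (λ a≈0 → 1≉0 (a≈0 zero)) , λ ()
    more-vectors-than-coordinates⇒dependent {suc d} v with all? (λ t → v zero t ≟0)
    ... | yes v₀≈0 = (1# ∷ λ _ → 0#) , (λ a≈0 → 1≉0 (a≈0 zero)) , λ t → begin
          1# * v zero t + sum (λ i → 0# * v (suc i) t)  ≈⟨ +-cong (*-identityˡ (v zero t)) (sum-≈0 (λ i → zeroˡ (v (suc i) t))) ⟩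
          v zero t + 0#                                 ≈⟨ +-identityʳ (v zero t) ⟩
          v zero t                                      ≈⟨ v₀≈0 t ⟩
          0#                                            ∎
    ... | no v₀≉0 with ¬∀⟶∃¬ _ _ (λ t → v zero t ≟0) v₀≉0
    ... | p , v₀ₚ≉0 with left-inverse v₀ₚ≉0
    ... | y , yv₀ₚ≈1 = LeftDependent-eliminate v yv₀ₚ≈1
                         (more-vectors-than-coordinates⇒dependent (λ i s → eliminate v p y i (punchIn p s)))

    rows-beyond-inner-dimension-dependent :
      ∀ {p q d} (A : Fin p → Fin q → Carrier) (B : Fin p → Fin d → Carrier) (C : Fin d → Fin q → Carrier) →
      (∀ j k → A j k ≈ sum (λ t → B j t * C t k)) → (r : Fin (suc d) → Fin p) → LeftDependent (A ∘ r)
    rows-beyond-inner-dimension-dependent A B C A≈BC r =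
      factor-LeftDependent (B ∘ r) C (A≈BC ∘ r) (more-vectors-than-coordinates⇒dependent (B ∘ r))

module RealField (ℝ : Reals) where
  open Reals ℝ using (R; 0ℝ; 1ℝ; _+_; _*_; -_; _<ℝ_; _≤ℝ_; <-irrefl; <-trans; <-trichotomy; +-mono-<; *-pos)

  commutativeRing : CommutativeRing 0ℓ 0ℓ
  commutativeRing = record
    { Carrier = R ; _≈_ = _≡_ ; _+_ = _+_ ; _*_ = _*_ ; -_ = -_ ; 0# = 0ℝ ; 1# = 1ℝ
    ; isCommutativeRing = record
      { isRing = record
        { +-isAbelianGroup = record
          { isGroup = record
            { isMonoid = record
              { isSemigroup = record
                { isMagma = record { isEquivalence = isEquivalence ; ∙-cong = cong₂ _+_ }
                ; assoc = Reals.+-assoc ℝ }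
              ; identity = comm∧idˡ⇒id (Reals.+-comm ℝ) (Reals.+-identityˡ ℝ) }
            ; inverse = comm∧invˡ⇒inv (Reals.+-comm ℝ) (Reals.+-inverseˡ ℝ)
            ; ⁻¹-cong = cong -_ }
          ; comm = Reals.+-comm ℝ }
        ; *-cong = cong₂ _*_
        ; *-assoc = Reals.*-assoc ℝ
        ; *-identity = comm∧idˡ⇒id (Reals.*-comm ℝ) (Reals.*-identityˡ ℝ)
        ; distrib = comm∧distrˡ⇒distr (cong₂ _+_) (Reals.*-comm ℝ) (Reals.distribˡ ℝ) }
      ; *-comm = Reals.*-comm ℝ } }

  open CommutativeRing commutativeRing
    using (_-_; +-comm; +-assoc; +-identityˡ; +-identityʳ; -‿inverseʳ; *-identityˡ; distribʳ; zeroˡ; ring)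
  open RingProperties ring using (-0#≈0#; -‿+-comm; ⁻¹-anti-homo‿-; -‿distribˡ-*; -‿distribʳ-*; -‿involutive;
                                  x[y-z]≈xy-xz; [y-z]x≈yx-zx)
  open ≡-Reasoning

  +-difference : ∀ w x y z → (w + x) - (y + z) ≡ (w - y) + (x - z)
  +-difference w x y z = begin
    (w + x) + - (y + z)    ≡⟨ cong ((w + x) +_) (-‿+-comm y z) ⟨
    (w + x) + (- y + - z)  ≡⟨ comm∧assoc⇒middleFour +-comm +-assoc w x (- y) (- z) ⟩
    (w + - y) + (x + - z)  ∎

  *-difference : ∀ w x y z → (w - x) * (y - z) ≡ (w * y + x * z) - (w * z + x * y)
  *-difference w x y z = begin
    (w - x) * (y - z)                ≡⟨ [y-z]x≈yx-zx (y - z) w x ⟩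
    w * (y - z) - x * (y - z)        ≡⟨ cong₂ _-_ (x[y-z]≈xy-xz w y z) (x[y-z]≈xy-xz x y z) ⟩
    (w * y - w * z) - (x * y - x * z) ≡⟨ cong ((w * y - w * z) +_) (⁻¹-anti-homo‿- (x * y) (x * z)) ⟩
    (w * y - w * z) + (x * z - x * y) ≡⟨ comm∧assoc⇒middleFour +-comm +-assoc (w * y) (- (w * z)) (x * z) (- (x * y)) ⟩
    (w * y + x * z) + (- (w * z) + - (x * y)) ≡⟨ cong ((w * y + x * z) +_) (-‿+-comm (w * z) (x * y)) ⟩
    (w * y + x * z) - (w * z + x * y) ∎

  -- Integers, encoded as differences (m , n) ↦ m - n kept in the canonical form with m ≡ 0 or n ≡ 0,
  -- are the coefficients of the ring solver.
  canonical : ℕ → ℕ → ℕ × ℕ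
  canonical m n = m ∸ n , n ∸ m

  _⊕_ _⊛_ : ℕ × ℕ → ℕ × ℕ → ℕ × ℕ
  (a , b) ⊕ (c , d) = canonical (a ℕ.+ c) (b ℕ.+ d)
  (a , b) ⊛ (c , d) = canonical (a ℕ.* c ℕ.+ b ℕ.* d) (a ℕ.* d ℕ.+ b ℕ.* c)

  integers : RawRing 0ℓ 0ℓ
  integers = record
    { Carrier = ℕ × ℕ ; _≈_ = _≡_ ; _+_ = _⊕_ ; _*_ = _⊛_ ; -_ = swap ; 0# = 0 , 0 ; 1# = 1 , 0 }

  -- ι 0 and ι 1 are definitionally 0ℝ and 1ℝ, so that the solver constants (0 , 0) and (1 , 0)
  -- evaluate to the very constants from which 0ℍ and 1ℍ are built.
  ι : ℕ → R
  ι zero          = 0ℝ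
  ι (suc zero)    = 1ℝ
  ι (suc (suc n)) = 1ℝ + ι (suc n)

  ι-suc : ∀ n → ι (suc n) ≡ 1ℝ + ι n
  ι-suc zero    = sym (+-identityʳ 1ℝ)
  ι-suc (suc n) = refl

  ι-+ : ∀ m n → ι (m ℕ.+ n) ≡ ι m + ι n
  ι-+ zero    n = sym (+-identityˡ (ι n))
  ι-+ (suc m) n = begin
    ι (suc (m ℕ.+ n))   ≡⟨ ι-suc (m ℕ.+ n) ⟩
    1ℝ + ι (m ℕ.+ n)    ≡⟨ cong (1ℝ +_) (ι-+ m n) ⟩
    1ℝ + (ι m + ι n)    ≡⟨ +-assoc 1ℝ (ι m) (ι n) ⟨
    (1ℝ + ι m) + ι n    ≡⟨ cong (_+ ι n) (ι-suc m) ⟨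
    ι (suc m) + ι n     ∎

  ι-* : ∀ m n → ι (m ℕ.* n) ≡ ι m * ι n
  ι-* zero    n = sym (zeroˡ (ι n))
  ι-* (suc m) n = begin
    ι (n ℕ.+ m ℕ.* n)        ≡⟨ ι-+ n (m ℕ.* n) ⟩
    ι n + ι (m ℕ.* n)        ≡⟨ cong₂ _+_ (sym (*-identityˡ (ι n))) (ι-* m n) ⟩
    1ℝ * ι n + ι m * ι n     ≡⟨ distribʳ (ι n) 1ℝ (ι m) ⟨
    (1ℝ + ι m) * ι n         ≡⟨ cong (_* ι n) (ι-suc m) ⟨
    ι (suc m) * ι n          ∎

  ⟦_⟧ℤ : ℕ × ℕ → R
  ⟦ m     , zero  ⟧ℤ = ι m
  ⟦ zero  , suc n ⟧ℤ = - ι (suc n)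
  ⟦ suc m , suc n ⟧ℤ = ⟦ m , n ⟧ℤ

  ⟦⟧ℤ-difference : ∀ m n → ⟦ m , n ⟧ℤ ≡ ι m - ι n
  ⟦⟧ℤ-difference m       zero    = sym (trans (cong (ι m +_) -0#≈0#) (+-identityʳ (ι m)))
  ⟦⟧ℤ-difference zero    (suc n) = sym (+-identityˡ (- ι (suc n)))
  ⟦⟧ℤ-difference (suc m) (suc n) = begin
    ⟦ m , n ⟧ℤ                    ≡⟨ ⟦⟧ℤ-difference m n ⟩
    ι m - ι n                     ≡⟨ +-identityˡ (ι m - ι n) ⟨
    0ℝ + (ι m - ι n)              ≡⟨ cong (_+ (ι m - ι n)) (-‿inverseʳ 1ℝ) ⟨
    (1ℝ - 1ℝ) + (ι m - ι n)       ≡⟨ +-difference 1ℝ (ι m) 1ℝ (ι n) ⟨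
    (1ℝ + ι m) - (1ℝ + ι n)       ≡⟨ cong₂ _-_ (ι-suc m) (ι-suc n) ⟨
    ι (suc m) - ι (suc n)         ∎

  ⟦canonical⟧ : ∀ m n → ⟦ canonical m n ⟧ℤ ≡ ⟦ m , n ⟧ℤ
  ⟦canonical⟧ zero    zero    = refl
  ⟦canonical⟧ zero    (suc n) = refl
  ⟦canonical⟧ (suc m) zero    = refl
  ⟦canonical⟧ (suc m) (suc n) = ⟦canonical⟧ m n

  ⟦canonical⟧-difference : ∀ m n → ⟦ canonical m n ⟧ℤ ≡ ι m - ι n
  ⟦canonical⟧-difference m n = trans (⟦canonical⟧ m n) (⟦⟧ℤ-difference m n)

  ⟦⟧ℤ-homomorphism : integers -Raw-AlmostCommutative⟶ fromCommutativeRing commutativeRing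
  ⟦⟧ℤ-homomorphism = record
    { ⟦_⟧    = ⟦_⟧ℤ
    ; +-homo = +-homo
    ; *-homo = *-homo
    ; -‿homo = -‿homo
    ; 0-homo = refl
    ; 1-homo = refl
    }
    where
    +-homo : ∀ x y → ⟦ x ⊕ y ⟧ℤ ≡ ⟦ x ⟧ℤ + ⟦ y ⟧ℤ
    +-homo (a , b) (c , d) = begin
      ⟦ canonical (a ℕ.+ c) (b ℕ.+ d) ⟧ℤ   ≡⟨ ⟦canonical⟧-difference (a ℕ.+ c) (b ℕ.+ d) ⟩
      ι (a ℕ.+ c) - ι (b ℕ.+ d)            ≡⟨ cong₂ _-_ (ι-+ a c) (ι-+ b d) ⟩
      (ι a + ι c) - (ι b + ι d)            ≡⟨ +-difference (ι a) (ι c) (ι b) (ι d) ⟩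
      (ι a - ι b) + (ι c - ι d)            ≡⟨ cong₂ _+_ (⟦⟧ℤ-difference a b) (⟦⟧ℤ-difference c d) ⟨
      ⟦ a , b ⟧ℤ + ⟦ c , d ⟧ℤ              ∎
    *-homo : ∀ x y → ⟦ x ⊛ y ⟧ℤ ≡ ⟦ x ⟧ℤ * ⟦ y ⟧ℤ
    *-homo (a , b) (c , d) = begin
      ⟦ canonical (a ℕ.* c ℕ.+ b ℕ.* d) (a ℕ.* d ℕ.+ b ℕ.* c) ⟧ℤ
        ≡⟨ ⟦canonical⟧-difference (a ℕ.* c ℕ.+ b ℕ.* d) (a ℕ.* d ℕ.+ b ℕ.* c) ⟩
      ι (a ℕ.* c ℕ.+ b ℕ.* d) - ι (a ℕ.* d ℕ.+ b ℕ.* c)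
        ≡⟨ cong₂ _-_ (trans (ι-+ (a ℕ.* c) (b ℕ.* d)) (cong₂ _+_ (ι-* a c) (ι-* b d)))
                     (trans (ι-+ (a ℕ.* d) (b ℕ.* c)) (cong₂ _+_ (ι-* a d) (ι-* b c))) ⟩
      (ι a * ι c + ι b * ι d) - (ι a * ι d + ι b * ι c)
        ≡⟨ *-difference (ι a) (ι b) (ι c) (ι d) ⟨
      (ι a - ι b) * (ι c - ι d)
        ≡⟨ cong₂ _*_ (⟦⟧ℤ-difference a b) (⟦⟧ℤ-difference c d) ⟨
      ⟦ a , b ⟧ℤ * ⟦ c , d ⟧ℤ ∎
    -‿homo : ∀ x → ⟦ swap x ⟧ℤ ≡ - ⟦ x ⟧ℤ
    -‿homo (a , b) = begin
      ⟦ b , a ⟧ℤ      ≡⟨ ⟦⟧ℤ-difference b a ⟩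
      ι b - ι a       ≡⟨ ⁻¹-anti-homo‿- (ι a) (ι b) ⟨
      - (ι a - ι b)   ≡⟨ cong -_ (⟦⟧ℤ-difference a b) ⟨
      - ⟦ a , b ⟧ℤ    ∎

  ⟦⟧ℤ-equal? : ∀ x y → Maybe (⟦ x ⟧ℤ ≡ ⟦ y ⟧ℤ)
  ⟦⟧ℤ-equal? x y = Maybe.map (cong ⟦_⟧ℤ) (dec⇒maybe (≡-dec ℕ._≟_ ℕ._≟_ x y))

  open import Algebra.Solver.Ring integers (fromCommutativeRing commutativeRing) ⟦⟧ℤ-homomorphism
    ⟦⟧ℤ-equal? public
    using (Polynomial; con; var; _:+_; _:*_; :-_; _:-_; ⟦_⟧; ⟦_⟧↓; prove)

  _≟ℝ_ : DecidableEquality R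
  x ≟ℝ y with <-trichotomy x y
  ... | inj₁ x<y        = no λ x≡y → <-irrefl y (subst (_<ℝ y) x≡y x<y)
  ... | inj₂ (inj₁ x≡y) = yes x≡y
  ... | inj₂ (inj₂ y<x) = no λ x≡y → <-irrefl y (subst (y <ℝ_) x≡y y<x)

  neg-pos : ∀ {x} → x <ℝ 0ℝ → 0ℝ <ℝ - x
  neg-pos {x} x<0 = subst₂ _<ℝ_ (-‿inverseʳ x) (+-identityˡ (- x)) (+-mono-< (- x) x<0)

  square-pos : ∀ {x} → x ≢ 0ℝ → 0ℝ <ℝ x * x
  square-pos {x} x≢0 with <-trichotomy 0ℝ x
  ... | inj₁ 0<x        = *-pos 0<x 0<x
  ... | inj₂ (inj₁ 0≡x) = contradiction (sym 0≡x) x≢0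
  ... | inj₂ (inj₂ x<0) = subst (0ℝ <ℝ_) -x*-x≡x*x (*-pos (neg-pos x<0) (neg-pos x<0))
    where
    -x*-x≡x*x : (- x) * (- x) ≡ x * x
    -x*-x≡x*x = begin
      (- x) * (- x)  ≡⟨ -‿distribˡ-* x (- x) ⟨
      - (x * - x)    ≡⟨ cong -_ (-‿distribʳ-* x x) ⟨
      - - (x * x)    ≡⟨ -‿involutive (x * x) ⟩
      x * x          ∎

  square-nonneg : ∀ x → 0ℝ ≤ℝ x * x
  square-nonneg x with x ≟ℝ 0ℝ
  ... | yes refl = inj₂ (sym (zeroˡ 0ℝ))
  ... | no x≢0   = inj₁ (square-pos x≢0)

  square≡0⇒≡0 : ∀ {x} → x * x ≡ 0ℝ → x ≡ 0ℝ
  square≡0⇒≡0 {x} x²≡0 with x ≟ℝ 0ℝ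
  ... | yes x≡0 = x≡0
  ... | no x≢0  = contradiction (subst (0ℝ <ℝ_) x²≡0 (square-pos x≢0)) (<-irrefl 0ℝ)

  pos+nonneg : ∀ {x y} → 0ℝ <ℝ x → 0ℝ ≤ℝ y → 0ℝ <ℝ x + y
  pos+nonneg {x} {y} 0<x (inj₁ 0<y) = <-trans 0<y (subst (_<ℝ x + y) (+-identityˡ y) (+-mono-< y 0<x))
  pos+nonneg {x}     0<x (inj₂ refl) = subst (0ℝ <ℝ_) (sym (+-identityʳ x)) 0<x

  +-nonneg : ∀ {x y} → 0ℝ ≤ℝ x → 0ℝ ≤ℝ y → 0ℝ ≤ℝ x + y
  +-nonneg         (inj₁ 0<x)  0≤y = inj₁ (pos+nonneg 0<x 0≤y)
  +-nonneg {y = y} (inj₂ refl) 0≤y = subst (0ℝ ≤ℝ_) (sym (+-identityˡ y)) 0≤y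

  nonneg+square≡0 : ∀ {x y} → 0ℝ ≤ℝ x → x + y * y ≡ 0ℝ → x ≡ 0ℝ × y ≡ 0ℝ
  nonneg+square≡0 {y = y} (inj₁ 0<x) x+y²≡0 =
    contradiction (subst (0ℝ <ℝ_) x+y²≡0 (pos+nonneg 0<x (square-nonneg y))) (<-irrefl 0ℝ)
  nonneg+square≡0 {y = y} (inj₂ refl) 0+y²≡0 =
    refl , square≡0⇒≡0 (trans (sym (+-identityˡ (y * y))) 0+y²≡0)

module QuaternionAlgebra (ℝ : Reals) where
  open Reals ℝ using (R; 0ℝ; 1ℝ; _*_; -_; 0≢1; *-inverse; *-comm)
  open Quaternions ℝ
  open RealField ℝ
    using (Polynomial; con; var; _:+_; _:*_; :-_; _:-_; ⟦_⟧; ⟦_⟧↓; prove;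
           _≟ℝ_; square-nonneg; square≡0⇒≡0; +-nonneg; nonneg+square≡0)
  open import Data.Vec.Base using (Vec; []; _∷_)

  -ℍ_ : ℍ → ℍ
  -ℍ quat a b c d = quat (- a) (- b) (- c) (- d)

  scalar : R → ℍ
  scalar x = quat x 0ℝ 0ℝ 0ℝ

  quat-cong : ∀ {a b c d a′ b′ c′ d′} → a ≡ a′ → b ≡ b′ → c ≡ c′ → d ≡ d′ → quat a b c d ≡ quat a′ b′ c′ d′
  quat-cong refl refl refl refl = refl

  -- Quaternions with polynomial coordinates: every identity of quaternion arithmetic is
  -- checked by the ring solver one coordinate at a time.
  data ℍᴾ (m : ℕ) : Set where
    quatᴾ : (a b c d : Polynomial m) → ℍᴾ m

  module _ {m : ℕ} where
    infixl 6 _+ᴾ_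
    infixl 7 _*ᴾ_

    0ᴿ 1ᴿ : Polynomial m
    0ᴿ = con (0 , 0)
    1ᴿ = con (1 , 0)

    scalarᴾ : Polynomial m → ℍᴾ m
    scalarᴾ x = quatᴾ x 0ᴿ 0ᴿ 0ᴿ

    0ᴾ 1ᴾ : ℍᴾ m
    0ᴾ = scalarᴾ 0ᴿ
    1ᴾ = scalarᴾ 1ᴿ

    _+ᴾ_ _*ᴾ_ : ℍᴾ m → ℍᴾ m → ℍᴾ m
    quatᴾ a b c d +ᴾ quatᴾ a′ b′ c′ d′ = quatᴾ (a :+ a′) (b :+ b′) (c :+ c′) (d :+ d′)
    quatᴾ a₁ b₁ c₁ d₁ *ᴾ quatᴾ a₂ b₂ c₂ d₂ =
      quatᴾ (a₁ :* a₂ :- b₁ :* b₂ :- c₁ :* c₂ :- d₁ :* d₂)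
            (a₁ :* b₂ :+ b₁ :* a₂ :+ c₁ :* d₂ :- d₁ :* c₂)
            (a₁ :* c₂ :- b₁ :* d₂ :+ c₁ :* a₂ :+ d₁ :* b₂)
            (a₁ :* d₂ :+ b₁ :* c₂ :- c₁ :* b₂ :+ d₁ :* a₂)

    -ᴾ_ conjᴾ : ℍᴾ m → ℍᴾ m
    -ᴾ quatᴾ a b c d = quatᴾ (:- a) (:- b) (:- c) (:- d)
    conjᴾ (quatᴾ a b c d) = quatᴾ a (:- b) (:- c) (:- d)

    normSqᴾ : ℍᴾ m → Polynomial m
    normSqᴾ (quatᴾ a b c d) = a :* a :+ b :* b :+ c :* c :+ d :* d

    ⟦_⟧ᴴ ⟦_⟧↓ᴴ : ℍᴾ m → Vec R m → ℍ
    ⟦ quatᴾ a b c d ⟧ᴴ  ρ = quat (⟦ a ⟧ ρ) (⟦ b ⟧ ρ) (⟦ c ⟧ ρ) (⟦ d ⟧ ρ)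
    ⟦ quatᴾ a b c d ⟧↓ᴴ ρ = quat (⟦ a ⟧↓ ρ) (⟦ b ⟧↓ ρ) (⟦ c ⟧↓ ρ) (⟦ d ⟧↓ ρ)

    proveᴴ : ∀ ρ x y → ⟦ x ⟧↓ᴴ ρ ≡ ⟦ y ⟧↓ᴴ ρ → ⟦ x ⟧ᴴ ρ ≡ ⟦ y ⟧ᴴ ρ
    proveᴴ ρ (quatᴾ a b c d) (quatᴾ a′ b′ c′ d′) eq =
      quat-cong (prove ρ a a′ (cong re eq)) (prove ρ b b′ (cong i eq))
                (prove ρ c c′ (cong j eq)) (prove ρ d d′ (cong k eq))

  infixr 5 _∷ᴴ_
  _∷ᴴ_ : ∀ {m} → ℍ → Vec R m → Vec R (4 ℕ.+ m)
  q ∷ᴴ ρ = re q ∷ i q ∷ j q ∷ k q ∷ ρ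

  quatVar : ∀ {m} l → ℍᴾ (l ℕ.+ (4 ℕ.+ m))
  quatVar l = quatᴾ (var (l ↑ʳ zero)) (var (l ↑ʳ suc zero))
                    (var (l ↑ʳ suc (suc zero))) (var (l ↑ʳ suc (suc (suc zero))))

  𝕡 : ∀ {m} → ℍᴾ (4 ℕ.+ m)
  𝕡 = quatVar 0
  𝕢 : ∀ {m} → ℍᴾ (8 ℕ.+ m)
  𝕢 = quatVar 4
  𝕣 : ∀ {m} → ℍᴾ (12 ℕ.+ m)
  𝕣 = quatVar 8

  +ℍ-assoc : ∀ p q r → (p +ℍ q) +ℍ r ≡ p +ℍ (q +ℍ r)
  +ℍ-assoc p q r = proveᴴ (p ∷ᴴ q ∷ᴴ r ∷ᴴ []) ((𝕡 +ᴾ 𝕢) +ᴾ 𝕣) (𝕡 +ᴾ (𝕢 +ᴾ 𝕣)) refl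

  +ℍ-comm : ∀ p q → p +ℍ q ≡ q +ℍ p
  +ℍ-comm p q = proveᴴ (p ∷ᴴ q ∷ᴴ []) (𝕡 +ᴾ 𝕢) (𝕢 +ᴾ 𝕡) refl

  +ℍ-identityˡ : ∀ p → 0ℍ +ℍ p ≡ p
  +ℍ-identityˡ p = proveᴴ (p ∷ᴴ []) (0ᴾ +ᴾ 𝕡) 𝕡 refl

  -ℍ‿inverseˡ : ∀ p → (-ℍ p) +ℍ p ≡ 0ℍ
  -ℍ‿inverseˡ p = proveᴴ (p ∷ᴴ []) (-ᴾ 𝕡 +ᴾ 𝕡) 0ᴾ refl

  *ℍ-assoc : ∀ p q r → (p *ℍ q) *ℍ r ≡ p *ℍ (q *ℍ r)
  *ℍ-assoc p q r = proveᴴ (p ∷ᴴ q ∷ᴴ r ∷ᴴ []) ((𝕡 *ᴾ 𝕢) *ᴾ 𝕣) (𝕡 *ᴾ (𝕢 *ᴾ 𝕣)) refl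

  *ℍ-identityˡ : ∀ p → 1ℍ *ℍ p ≡ p
  *ℍ-identityˡ p = proveᴴ (p ∷ᴴ []) (1ᴾ *ᴾ 𝕡) 𝕡 refl

  *ℍ-identityʳ : ∀ p → p *ℍ 1ℍ ≡ p
  *ℍ-identityʳ p = proveᴴ (p ∷ᴴ []) (𝕡 *ᴾ 1ᴾ) 𝕡 refl

  *ℍ-distribˡ : ∀ p q r → p *ℍ (q +ℍ r) ≡ p *ℍ q +ℍ p *ℍ r
  *ℍ-distribˡ p q r = proveᴴ (p ∷ᴴ q ∷ᴴ r ∷ᴴ []) (𝕡 *ᴾ (𝕢 +ᴾ 𝕣)) (𝕡 *ᴾ 𝕢 +ᴾ 𝕡 *ᴾ 𝕣) refl

  *ℍ-distribʳ : ∀ p q r → (q +ℍ r) *ℍ p ≡ q *ℍ p +ℍ r *ℍ p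
  *ℍ-distribʳ p q r = proveᴴ (p ∷ᴴ q ∷ᴴ r ∷ᴴ []) ((𝕢 +ᴾ 𝕣) *ᴾ 𝕡) (𝕢 *ᴾ 𝕡 +ᴾ 𝕣 *ᴾ 𝕡) refl

  *-conj : ∀ q → q *ℍ conj q ≡ scalar (normSq q)
  *-conj q = proveᴴ (q ∷ᴴ []) (𝕡 *ᴾ conjᴾ 𝕡) (scalarᴾ (normSqᴾ 𝕡)) refl

  scalar-*-conj-* : ∀ t q → (scalar t *ℍ conj q) *ℍ q ≡ scalar (t * normSq q)
  scalar-*-conj-* t q = proveᴴ (q ∷ᴴ t ∷ []) ((scalarᴾ 𝕥 *ᴾ conjᴾ 𝕡) *ᴾ 𝕡) (scalarᴾ (𝕥 :* normSqᴾ 𝕡)) refl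
    where
    𝕥 : Polynomial 5
    𝕥 = var (fromℕ 4)

  normSq-0ℍ : normSq 0ℍ ≡ 0ℝ
  normSq-0ℍ = prove [] (normSqᴾ 0ᴾ) 0ᴿ refl

  ℍ-ring : Ring 0ℓ 0ℓ
  ℍ-ring = record
    { Carrier = ℍ ; _≈_ = _≡_ ; _+_ = _+ℍ_ ; _*_ = _*ℍ_ ; -_ = -ℍ_ ; 0# = 0ℍ ; 1# = 1ℍ
    ; isRing = record
      { +-isAbelianGroup = record
        { isGroup = record
          { isMonoid = record
            { isSemigroup = record
              { isMagma = record { isEquivalence = isEquivalence ; ∙-cong = cong₂ _+ℍ_ }
              ; assoc = +ℍ-assoc }
            ; identity = comm∧idˡ⇒id +ℍ-comm +ℍ-identityˡ }
          ; inverse = comm∧invˡ⇒inv +ℍ-comm -ℍ‿inverseˡ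
          ; ⁻¹-cong = cong -ℍ_ }
        ; comm = +ℍ-comm }
      ; *-cong = cong₂ _*ℍ_
      ; *-assoc = *ℍ-assoc
      ; *-identity = *ℍ-identityˡ , *ℍ-identityʳ
      ; distrib = *ℍ-distribˡ , *ℍ-distribʳ } }

  1ℍ≢0ℍ : 1ℍ ≢ 0ℍ
  1ℍ≢0ℍ 1≡0 = 0≢1 (sym (cong re 1≡0))

  normSq≡0⇒≡0ℍ : ∀ q → normSq q ≡ 0ℝ → q ≡ 0ℍ
  normSq≡0⇒≡0ℍ (quat a b c d) ∣q∣²≡0
    with (abc≡0 , d≡0) ← nonneg+square≡0 (+-nonneg (+-nonneg (square-nonneg a) (square-nonneg b))
                                                    (square-nonneg c)) ∣q∣²≡0
    with (ab≡0 , c≡0)  ← nonneg+square≡0 (+-nonneg (square-nonneg a) (square-nonneg b)) abc≡0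
    with (a²≡0 , b≡0)  ← nonneg+square≡0 (square-nonneg a) ab≡0
    = quat-cong (square≡0⇒≡0 a²≡0) b≡0 c≡0 d≡0

  _≟0ℍ : ∀ q → Dec (q ≡ 0ℍ)
  q ≟0ℍ with normSq q ≟ℝ 0ℝ
  ... | yes ∣q∣²≡0 = yes (normSq≡0⇒≡0ℍ q ∣q∣²≡0)
  ... | no ∣q∣²≢0  = no λ q≡0 → ∣q∣²≢0 (trans (cong normSq q≡0) normSq-0ℍ)

  left-inverse : ∀ {q} → q ≢ 0ℍ → ∃ λ p → p *ℍ q ≡ 1ℍ
  left-inverse {q} q≢0 with *-inverse (normSq q) (λ ∣q∣²≡0 → q≢0 (normSq≡0⇒≡0ℍ q ∣q∣²≡0))
  ... | t , ∣q∣²t≡1 = scalar t *ℍ conj q ,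
                      trans (scalar-*-conj-* t q) (cong scalar (trans (*-comm t (normSq q)) ∣q∣²t≡1))

  unit-*-conj : ∀ {q} → IsUnit q → q *ℍ conj q ≡ 1ℍ
  unit-*-conj {q} ∣q∣²≡1 = trans (*-conj q) (cong scalar ∣q∣²≡1)

module GainGraphRank (ℝ : Reals) {n : ℕ} (Γ : Quaternions.GainGraph ℝ n) where
  open Quaternions ℝ
  open QuaternionAlgebra ℝ using (-ℍ_; ℍ-ring; _≟0ℍ; left-inverse; 1ℍ≢0ℍ; unit-*-conj)
  open GainGraph Γ renaming (sym to E-sym)
  open Ring ℍ-ring using (*-assoc; *-identityˡ; *-identityʳ; zeroˡ; zeroʳ; +-identityˡ; +-identityʳ)
  open import Algebra.Properties.Ring ℍ-ring using (-‿distribˡ-*; +-inverseˡ-unique)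
  open LeftLinearDependence ℍ-ring
  open DivisionRing _≟0ℍ left-inverse 1ℍ≢0ℍ
  open import Data.Vec.Functional using (_∷_; [])
  open ≡-Reasoning

  A : Matrix n n
  A = adjMatrix Γ

  adj-edge : ∀ {u v} → E u v ≡ true → A u v ≡ φ u v
  adj-edge {u} {v} = cong (λ b → if b then φ u v else 0ℍ)

  adj-non-edge : ∀ {u v} → E u v ≡ false → A u v ≡ 0ℍ
  adj-non-edge {u} {v} = cong (λ b → if b then φ u v else 0ℍ)

  E-sym′ : ∀ {u v} → E u v ≡ true → E v u ≡ true
  E-sym′ {u} {v} = trans (E-sym v u)

  φ-*-φ : ∀ {u v} → E u v ≡ true → φ u v *ℍ φ v u ≡ 1ℍ
  φ-*-φ {u} {v} e = trans (cong (φ u v *ℍ_) (φ-conj v u (E-sym′ e))) (unit-*-conj (φ-unit u v e))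

  φ≢0 : ∀ {u v} → E u v ≡ true → φ u v ≢ 0ℍ
  φ≢0 {u} {v} e φ≡0 = 1ℍ≢0ℍ (trans (sym (φ-*-φ e)) (trans (cong (_*ℍ φ v u) φ≡0) (zeroˡ (φ v u))))

  *φ≡0⇒≡0 : ∀ {u v x} → E u v ≡ true → x *ℍ φ u v ≡ 0ℍ → x ≡ 0ℍ
  *φ≡0⇒≡0 {u} {v} {x} e xφ≡0 = begin
    x                           ≡⟨ *-identityʳ x ⟨
    x *ℍ 1ℍ                     ≡⟨ cong (x *ℍ_) (φ-*-φ e) ⟨
    x *ℍ (φ u v *ℍ φ v u)       ≡⟨ *-assoc x (φ u v) (φ v u) ⟨
    (x *ℍ φ u v) *ℍ φ v u       ≡⟨ cong (_*ℍ φ v u) xφ≡0 ⟩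
    0ℍ *ℍ φ v u                 ≡⟨ zeroˡ (φ v u) ⟩
    0ℍ                          ∎

  nonzero⇒edge : ¬ HasFactorization A 0 → ∃₂ λ u v → E u v ≡ true
  nonzero⇒edge A≢0 with any? (λ u → any? (λ v → E u v ≟ᴮ true))
  ... | yes edge   = edge
  ... | no no-edge = contradiction ((λ _ ()) , (λ ()) , A≡0) A≢0
    where
    A≡0 : ∀ u v → A u v ≡ 0ℍ
    A≡0 u v = adj-non-edge (¬-not λ e → no-edge (u , v , e))

  rank≤2⇒three-rows-dependent : HasFactorization A 2 → (r : Fin 3 → Fin n) → LeftDependent (A ∘ r)
  rank≤2⇒three-rows-dependent (B , C , A≡BC) = rows-beyond-inner-dimension-dependent A B C A≡BC

  record RowDependency (a c : Fin n) : Set where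
    field
      κ₀ κ₁      : ℍ
      nontrivial : ¬ (κ₀ ≡ 0ℍ × κ₁ ≡ 0ℍ)
      relation   : ∀ k → κ₀ *ℍ A a k +ℍ κ₁ *ℍ A c k ≡ 0ℍ

  module Colouring (col : Fin n → Bool) (bip : ∀ u v → E u v ≡ true → col u ≢ col v) where

    same-colour⇒A≡0 : ∀ {u v} → col u ≡ col v → A u v ≡ 0ℍ
    same-colour⇒A≡0 {u} {v} cu≡cv = adj-non-edge (¬-not λ e → bip u v e cu≡cv)

    opposite-colour : ∀ {u v} → E u v ≡ true → col v ≡ not (col u)
    opposite-colour {u} {v} e = ¬-not (bip v u (E-sym′ e))

    two-steps-same-colour : ∀ {u v w} → E u v ≡ true → E v w ≡ true → col u ≡ col w
    two-steps-same-colour euv evw = trans (opposite-colour (E-sym′ euv)) (sym (opposite-colour evw))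

    true-false⇒≢ : ∀ {u v} → col u ≡ true → col v ≡ false → col u ≢ col v
    true-false⇒≢ cu cv cu≡cv with trans (sym cu) (trans cu≡cv cv)
    ... | ()

    both-colours : ∀ {u v} → E u v ≡ true → (∃ λ x → col x ≡ true) × (∃ λ x → col x ≡ false)
    both-colours {u} {v} e with col u in cu
    ... | true  = (u , cu) , (v , trans (opposite-colour e) (cong not cu))
    ... | false = (v , trans (opposite-colour e) (cong not cu)) , (u , cu)

    module RankAtMostTwo (rank≤2 : HasFactorization A 2) where

      -- Row b is the only one of the rows a, c, b with a nonzero entry in column a, so it
      -- drops out of any dependency among them.
      same-side-rows-dependent : ∀ {a b c} → E a b ≡ true → col a ≡ col c → RowDependency a c
      same-side-rows-dependent {a} {b} {c} eab ca≡cc =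
        drop-row-b (rank≤2⇒three-rows-dependent rank≤2 (a ∷ c ∷ b ∷ []))
        where
        drop-row-b : LeftDependent (A ∘ (a ∷ c ∷ b ∷ [])) → RowDependency a c
        drop-row-b (μ , μ≢0 , μA≡0) =
          record { κ₀ = μ₀ ; κ₁ = μ₁ ; nontrivial = nontrivial ; relation = relation }
          where
          μ₀ μ₁ μ₂ : ℍ
          μ₀ = μ zero
          μ₁ = μ (suc zero)
          μ₂ = μ (suc (suc zero))

          μ₂≡0 : μ₂ ≡ 0ℍ
          μ₂≡0 = *φ≡0⇒≡0 (E-sym′ eab) (begin
            μ₂ *ℍ φ b a                                            ≡⟨ +-identityˡ (μ₂ *ℍ φ b a) ⟨
            0ℍ +ℍ μ₂ *ℍ φ b a                                      ≡⟨ +-identityˡ (0ℍ +ℍ μ₂ *ℍ φ b a) ⟨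
            0ℍ +ℍ (0ℍ +ℍ μ₂ *ℍ φ b a)                              ≡⟨ cong₂ _+ℍ_ column-a₀ (cong₂ _+ℍ_ column-a₁ column-a₂) ⟨
            μ₀ *ℍ A a a +ℍ (μ₁ *ℍ A c a +ℍ (μ₂ *ℍ A b a +ℍ 0ℍ))   ≡⟨ μA≡0 a ⟩
            0ℍ                                                     ∎)
            where
            column-a₀ : μ₀ *ℍ A a a ≡ 0ℍ
            column-a₀ = trans (cong (μ₀ *ℍ_) (adj-non-edge (irrefl a))) (zeroʳ μ₀)
            column-a₁ : μ₁ *ℍ A c a ≡ 0ℍ
            column-a₁ = trans (cong (μ₁ *ℍ_) (same-colour⇒A≡0 (sym ca≡cc))) (zeroʳ μ₁)
            column-a₂ : μ₂ *ℍ A b a +ℍ 0ℍ ≡ μ₂ *ℍ φ b a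
            column-a₂ = trans (+-identityʳ (μ₂ *ℍ A b a)) (cong (μ₂ *ℍ_) (adj-edge (E-sym′ eab)))

          nontrivial : ¬ (μ₀ ≡ 0ℍ × μ₁ ≡ 0ℍ)
          nontrivial (μ₀≡0 , μ₁≡0) = μ≢0 λ { zero → μ₀≡0 ; (suc zero) → μ₁≡0 ; (suc (suc zero)) → μ₂≡0 }

          relation : ∀ k → μ₀ *ℍ A a k +ℍ μ₁ *ℍ A c k ≡ 0ℍ
          relation k = begin
            μ₀ *ℍ A a k +ℍ μ₁ *ℍ A c k                            ≡⟨ cong (μ₀ *ℍ A a k +ℍ_) (+-identityʳ (μ₁ *ℍ A c k)) ⟨
            μ₀ *ℍ A a k +ℍ (μ₁ *ℍ A c k +ℍ 0ℍ)                    ≡⟨ cong (λ x → μ₀ *ℍ A a k +ℍ (μ₁ *ℍ A c k +ℍ x)) row-b ⟨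
            μ₀ *ℍ A a k +ℍ (μ₁ *ℍ A c k +ℍ (μ₂ *ℍ A b k +ℍ 0ℍ))   ≡⟨ μA≡0 k ⟩
            0ℍ                                                     ∎
            where
            row-b : μ₂ *ℍ A b k +ℍ 0ℍ ≡ 0ℍ
            row-b = trans (+-identityʳ (μ₂ *ℍ A b k)) (trans (cong (_*ℍ A b k) μ₂≡0) (zeroˡ (A b k)))

      path₃-closes : ∀ {a b c d} → E a b ≡ true → E b c ≡ true → E c d ≡ true → E a d ≡ true
      path₃-closes {a} {b} {c} {d} eab ebc ecd =
        ¬-not (¬ead (same-side-rows-dependent eab (two-steps-same-colour eab ebc)))
        where
        ¬ead : RowDependency a c → E a d ≢ false
        ¬ead dependency ead = nontrivial (κ₀≡0 , κ₁≡0)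
          where
          open RowDependency dependency
          κ₁≡0 : κ₁ ≡ 0ℍ
          κ₁≡0 = *φ≡0⇒≡0 ecd (begin
            κ₁ *ℍ φ c d                   ≡⟨ +-identityˡ (κ₁ *ℍ φ c d) ⟨
            0ℍ +ℍ κ₁ *ℍ φ c d             ≡⟨ cong₂ _+ℍ_ (trans (cong (κ₀ *ℍ_) (adj-non-edge ead)) (zeroʳ κ₀))
                                                        (cong (κ₁ *ℍ_) (adj-edge ecd)) ⟨
            κ₀ *ℍ A a d +ℍ κ₁ *ℍ A c d    ≡⟨ relation d ⟩
            0ℍ                            ∎)
          κ₀≡0 : κ₀ ≡ 0ℍ
          κ₀≡0 = *φ≡0⇒≡0 eab (begin
            κ₀ *ℍ φ a b                   ≡⟨ +-identityʳ (κ₀ *ℍ φ a b) ⟨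
            κ₀ *ℍ φ a b +ℍ 0ℍ             ≡⟨ cong₂ _+ℍ_ (cong (κ₀ *ℍ_) (adj-edge eab))
                                                        (trans (cong (_*ℍ A c b) κ₁≡0) (zeroˡ (A c b))) ⟨
            κ₀ *ℍ A a b +ℍ κ₁ *ℍ A c b    ≡⟨ relation b ⟩
            0ℍ                            ∎)

      odd-walk⇒edge : ∀ {u w v} → E u w ≡ true → Walk Γ w v → col u ≢ col v → E u v ≡ true
      odd-walk⇒edge euw here                          _     = euw
      odd-walk⇒edge euw (step eww′ here)              cu≢cv = contradiction (two-steps-same-colour euw eww′) cu≢cv
      odd-walk⇒edge euw (step eww′ (step ew′w″ walk)) cu≢cv = odd-walk⇒edge (path₃-closes euw eww′ ew′w″) walk cu≢cv

      connected⇒complete : Connected Γ → ∀ {u v} → col u ≢ col v → E u v ≡ true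
      connected⇒complete connected {u} {v} cu≢cv with connected u v
      ... | here          = contradiction refl cu≢cv
      ... | step euw walk = odd-walk⇒edge euw walk cu≢cv

      4-cycle-gain : ∀ {a b c d} → E a b ≡ true → E b c ≡ true → E c d ≡ true → E d a ≡ true →
                     gain4 Γ a b c d ≡ 1ℍ
      4-cycle-gain {a} {b} {c} {d} eab ebc ecd eda =
        gain≡1 (same-side-rows-dependent eab (two-steps-same-colour eab ebc))
        where
        gain≡1 : RowDependency a c → gain4 Γ a b c d ≡ 1ℍ
        gain≡1 dependency = *-cancelˡ κ₀≢0 (begin
          κ₀ *ℍ gain4 Γ a b c d                             ≡⟨ reassociate ⟩
          (((κ₀ *ℍ φ a b) *ℍ φ b c) *ℍ φ c d) *ℍ φ d a      ≡⟨ cong (λ x → ((x *ℍ φ b c) *ℍ φ c d) *ℍ φ d a) via-b ⟩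
          (((-ℍ (κ₁ *ℍ φ c b)) *ℍ φ b c) *ℍ φ c d) *ℍ φ d a ≡⟨ cong (λ x → (x *ℍ φ c d) *ℍ φ d a) back-and-forth ⟩
          ((-ℍ κ₁) *ℍ φ c d) *ℍ φ d a                      ≡⟨ cong (_*ℍ φ d a) (-‿distribˡ-* κ₁ (φ c d)) ⟨
          (-ℍ (κ₁ *ℍ φ c d)) *ℍ φ d a                      ≡⟨ cong (_*ℍ φ d a) via-d ⟨
          (κ₀ *ℍ φ a d) *ℍ φ d a                            ≡⟨ *-assoc κ₀ (φ a d) (φ d a) ⟩
          κ₀ *ℍ (φ a d *ℍ φ d a)                            ≡⟨ cong (κ₀ *ℍ_) (φ-*-φ (E-sym′ eda)) ⟩
          κ₀ *ℍ 1ℍ                                          ∎)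
          where
          open RowDependency dependency
          via-b : κ₀ *ℍ φ a b ≡ -ℍ (κ₁ *ℍ φ c b)
          via-b = +-inverseˡ-unique (κ₀ *ℍ φ a b) (κ₁ *ℍ φ c b)
                    (trans (cong₂ (λ x y → κ₀ *ℍ x +ℍ κ₁ *ℍ y) (sym (adj-edge eab)) (sym (adj-edge (E-sym′ ebc)))) (relation b))

          via-d : κ₀ *ℍ φ a d ≡ -ℍ (κ₁ *ℍ φ c d)
          via-d = +-inverseˡ-unique (κ₀ *ℍ φ a d) (κ₁ *ℍ φ c d)
                    (trans (cong₂ (λ x y → κ₀ *ℍ x +ℍ κ₁ *ℍ y) (sym (adj-edge (E-sym′ eda))) (sym (adj-edge ecd))) (relation d))

          κ₀≢0 : κ₀ ≢ 0ℍ
          κ₀≢0 κ₀≡0 = nontrivial (κ₀≡0 , *φ≡0⇒≡0 (E-sym′ ebc) (begin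
            κ₁ *ℍ φ c b                   ≡⟨ +-identityˡ (κ₁ *ℍ φ c b) ⟨
            0ℍ +ℍ κ₁ *ℍ φ c b             ≡⟨ cong (_+ℍ κ₁ *ℍ φ c b) (trans (cong (_*ℍ φ a b) κ₀≡0) (zeroˡ (φ a b))) ⟨
            κ₀ *ℍ φ a b +ℍ κ₁ *ℍ φ c b    ≡⟨ cong₂ (λ x y → κ₀ *ℍ x +ℍ κ₁ *ℍ y) (adj-edge eab) (adj-edge (E-sym′ ebc)) ⟨
            κ₀ *ℍ A a b +ℍ κ₁ *ℍ A c b    ≡⟨ relation b ⟩
            0ℍ                            ∎))

          reassociate : κ₀ *ℍ (((φ a b *ℍ φ b c) *ℍ φ c d) *ℍ φ d a) ≡ (((κ₀ *ℍ φ a b) *ℍ φ b c) *ℍ φ c d) *ℍ φ d a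
          reassociate = begin
            κ₀ *ℍ (((φ a b *ℍ φ b c) *ℍ φ c d) *ℍ φ d a)  ≡⟨ *-assoc κ₀ ((φ a b *ℍ φ b c) *ℍ φ c d) (φ d a) ⟨
            (κ₀ *ℍ ((φ a b *ℍ φ b c) *ℍ φ c d)) *ℍ φ d a  ≡⟨ cong (_*ℍ φ d a) (*-assoc κ₀ (φ a b *ℍ φ b c) (φ c d)) ⟨
            ((κ₀ *ℍ (φ a b *ℍ φ b c)) *ℍ φ c d) *ℍ φ d a  ≡⟨ cong (λ x → (x *ℍ φ c d) *ℍ φ d a) (*-assoc κ₀ (φ a b) (φ b c)) ⟨
            (((κ₀ *ℍ φ a b) *ℍ φ b c) *ℍ φ c d) *ℍ φ d a  ∎

          back-and-forth : (-ℍ (κ₁ *ℍ φ c b)) *ℍ φ b c ≡ -ℍ κ₁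
          back-and-forth = begin
            (-ℍ (κ₁ *ℍ φ c b)) *ℍ φ b c   ≡⟨ -‿distribˡ-* (κ₁ *ℍ φ c b) (φ b c) ⟨
            -ℍ ((κ₁ *ℍ φ c b) *ℍ φ b c)   ≡⟨ cong -ℍ_ (*-assoc κ₁ (φ c b) (φ b c)) ⟩
            -ℍ (κ₁ *ℍ (φ c b *ℍ φ b c))   ≡⟨ cong (λ x → -ℍ (κ₁ *ℍ x)) (φ-*-φ (E-sym′ ebc)) ⟩
            -ℍ (κ₁ *ℍ 1ℍ)                 ≡⟨ cong -ℍ_ (*-identityʳ κ₁) ⟩
            -ℍ κ₁                         ∎

    module CompleteWithTrivialGains
      (complete : ∀ u v → col u ≢ col v → E u v ≡ true)
      (gains : All4CyclesGainOne Γ)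
      where

      different-colours⇒≢ : ∀ {u v} → col u ≢ col v → u ≢ v
      different-colours⇒≢ cu≢cv u≡v = cu≢cv (cong col u≡v)

      φ-through : ∀ {j k s t} → col s ≡ col j → col t ≡ col k → col j ≢ col k →
                  φ j k ≡ (φ j t *ℍ φ t s) *ℍ φ s k
      φ-through {j} {k} {s} {t} cs≡cj ct≡ck cj≢ck = cases (j ≟ᶠ s) (k ≟ᶠ t)
        where
        cj≢ct : col j ≢ col t
        cj≢ct cj≡ct = cj≢ck (trans cj≡ct ct≡ck)
        ct≢cs : col t ≢ col s
        ct≢cs ct≡cs = cj≢ck (trans (sym cs≡cj) (trans (sym ct≡cs) ct≡ck))
        cs≢ck : col s ≢ col k
        cs≢ck cs≡ck = cj≢ck (trans (sym cs≡cj) cs≡ck)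
        ejt : E j t ≡ true
        ejt = complete j t cj≢ct
        ets : E t s ≡ true
        ets = complete t s ct≢cs
        esk : E s k ≡ true
        esk = complete s k cs≢ck
        eks : E k s ≡ true
        eks = E-sym′ esk
        ekj : E k j ≡ true
        ekj = complete k j (λ ck≡cj → cj≢ck (sym ck≡cj))

        cases : Dec (j ≡ s) → Dec (k ≡ t) → φ j k ≡ (φ j t *ℍ φ t s) *ℍ φ s k
        cases (yes refl) _ = begin
          φ j k                        ≡⟨ *-identityˡ (φ j k) ⟨
          1ℍ *ℍ φ j k                  ≡⟨ cong (_*ℍ φ j k) (φ-*-φ ejt) ⟨
          (φ j t *ℍ φ t j) *ℍ φ j k    ∎
        cases (no _) (yes refl) = begin
          φ j k                        ≡⟨ *-identityʳ (φ j k) ⟨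
          φ j k *ℍ 1ℍ                  ≡⟨ cong (φ j k *ℍ_) (φ-*-φ eks) ⟨
          φ j k *ℍ (φ k s *ℍ φ s k)    ≡⟨ *-assoc (φ j k) (φ k s) (φ s k) ⟨
          (φ j k *ℍ φ k s) *ℍ φ s k    ∎
        cases (no j≢s) (no k≢t) = begin
          φ j k                                              ≡⟨ *-identityˡ (φ j k) ⟨
          1ℍ *ℍ φ j k                                        ≡⟨ cong (_*ℍ φ j k) (gains j t s k cycle) ⟨
          (((φ j t *ℍ φ t s) *ℍ φ s k) *ℍ φ k j) *ℍ φ j k    ≡⟨ *-assoc ((φ j t *ℍ φ t s) *ℍ φ s k) (φ k j) (φ j k) ⟩
          ((φ j t *ℍ φ t s) *ℍ φ s k) *ℍ (φ k j *ℍ φ j k)    ≡⟨ cong ((φ j t *ℍ φ t s) *ℍ φ s k *ℍ_) (φ-*-φ ekj) ⟩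
          ((φ j t *ℍ φ t s) *ℍ φ s k) *ℍ 1ℍ                  ≡⟨ *-identityʳ ((φ j t *ℍ φ t s) *ℍ φ s k) ⟩
          (φ j t *ℍ φ t s) *ℍ φ s k                          ∎
          where
          cycle : Is4Cycle Γ j t s k
          cycle = different-colours⇒≢ cj≢ct , j≢s , different-colours⇒≢ cj≢ck , different-colours⇒≢ ct≢cs ,
                  (λ t≡k → k≢t (sym t≡k)) , different-colours⇒≢ cs≢ck , ejt , ets , esk , ekj

      module _ {u₀ w₀ : Fin n} (cu₀ : col u₀ ≡ true) (cw₀ : col w₀ ≡ false) where

        -- φ j k factors through the fixed edge u₀ w₀ as (φ j w₀) (φ w₀ u₀ φ u₀ k) when col j is true,
        -- and as (φ j u₀) (φ u₀ w₀ φ w₀ k) when col j is false.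
        row : Fin n → Fin 2 → ℍ
        row j = if col j then φ j w₀ ∷ 0ℍ ∷ [] else 0ℍ ∷ φ j u₀ ∷ []

        column : Fin n → Fin 2 → ℍ
        column k = if col k then 0ℍ ∷ φ u₀ w₀ *ℍ φ w₀ k ∷ [] else φ w₀ u₀ *ℍ φ u₀ k ∷ 0ℍ ∷ []

        A≡row·column : ∀ j k → A j k ≡ sumℍ (λ i → row j i *ℍ column k i)
        A≡row·column j k with col j in cj | col k in ck
        ... | true | true = begin
          A j k                                                      ≡⟨ same-colour⇒A≡0 (trans cj (sym ck)) ⟩
          0ℍ                                                         ≡⟨ +-identityˡ 0ℍ ⟨
          0ℍ +ℍ 0ℍ                                                   ≡⟨ cong₂ _+ℍ_ (zeroʳ (φ j w₀)) (trans (+-identityʳ (0ℍ *ℍ x)) (zeroˡ x)) ⟨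
          φ j w₀ *ℍ 0ℍ +ℍ (0ℍ *ℍ x +ℍ 0ℍ)                            ∎
          where
          x : ℍ
          x = φ u₀ w₀ *ℍ φ w₀ k
        ... | false | false = begin
          A j k                                                      ≡⟨ same-colour⇒A≡0 (trans cj (sym ck)) ⟩
          0ℍ                                                         ≡⟨ +-identityˡ 0ℍ ⟨
          0ℍ +ℍ 0ℍ                                                   ≡⟨ cong₂ _+ℍ_ (zeroˡ x) (trans (+-identityʳ (φ j u₀ *ℍ 0ℍ)) (zeroʳ (φ j u₀))) ⟨
          0ℍ *ℍ x +ℍ (φ j u₀ *ℍ 0ℍ +ℍ 0ℍ)                            ∎
          where
          x : ℍ
          x = φ w₀ u₀ *ℍ φ u₀ k
        ... | true | false = begin
          A j k                                                      ≡⟨ adj-edge (complete j k cj≢ck) ⟩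
          φ j k                                                      ≡⟨ φ-through (trans cu₀ (sym cj)) (trans cw₀ (sym ck)) cj≢ck ⟩
          (φ j w₀ *ℍ φ w₀ u₀) *ℍ φ u₀ k                              ≡⟨ *-assoc (φ j w₀) (φ w₀ u₀) (φ u₀ k) ⟩
          φ j w₀ *ℍ x                                                ≡⟨ +-identityʳ (φ j w₀ *ℍ x) ⟨
          φ j w₀ *ℍ x +ℍ 0ℍ                                          ≡⟨ cong (φ j w₀ *ℍ x +ℍ_) (trans (+-identityʳ (0ℍ *ℍ 0ℍ)) (zeroˡ 0ℍ)) ⟨
          φ j w₀ *ℍ x +ℍ (0ℍ *ℍ 0ℍ +ℍ 0ℍ)                            ∎
          where
          x : ℍ
          x = φ w₀ u₀ *ℍ φ u₀ k
          cj≢ck : col j ≢ col k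
          cj≢ck = true-false⇒≢ cj ck
        ... | false | true = begin
          A j k                                                      ≡⟨ adj-edge (complete j k cj≢ck) ⟩
          φ j k                                                      ≡⟨ φ-through (trans cw₀ (sym cj)) (trans cu₀ (sym ck)) cj≢ck ⟩
          (φ j u₀ *ℍ φ u₀ w₀) *ℍ φ w₀ k                              ≡⟨ *-assoc (φ j u₀) (φ u₀ w₀) (φ w₀ k) ⟩
          φ j u₀ *ℍ x                                                ≡⟨ +-identityʳ (φ j u₀ *ℍ x) ⟨
          φ j u₀ *ℍ x +ℍ 0ℍ                                          ≡⟨ +-identityˡ (φ j u₀ *ℍ x +ℍ 0ℍ) ⟨
          0ℍ +ℍ (φ j u₀ *ℍ x +ℍ 0ℍ)                                  ≡⟨ cong (_+ℍ (φ j u₀ *ℍ x +ℍ 0ℍ)) (zeroˡ 0ℍ) ⟨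
          0ℍ *ℍ 0ℍ +ℍ (φ j u₀ *ℍ x +ℍ 0ℍ)                            ∎
          where
          x : ℍ
          x = φ u₀ w₀ *ℍ φ w₀ k
          cj≢ck : col j ≢ col k
          cj≢ck cj≡ck = true-false⇒≢ ck cj (sym cj≡ck)

        rank-two : IsRank A 2
        rank-two = (row , (λ i k → column k i) , A≡row·column) , no-smaller
          where
          eu₀w₀ : E u₀ w₀ ≡ true
          eu₀w₀ = complete u₀ w₀ (true-false⇒≢ cu₀ cw₀)

          no-smaller : ∀ s → s <ℕ 2 → ¬ HasFactorization A s
          no-smaller zero _ (B , C , A≡BC) = φ≢0 eu₀w₀ (trans (sym (adj-edge eu₀w₀)) (A≡BC u₀ w₀))
          no-smaller (suc zero) _ (B , C , A≡BC) =
            ¬inner-dimension-one (adj-non-edge (irrefl u₀))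
                                 (λ A≡0 → φ≢0 eu₀w₀ (trans (sym (adj-edge eu₀w₀)) A≡0))
                                 (λ A≡0 → φ≢0 (E-sym′ eu₀w₀) (trans (sym (adj-edge (E-sym′ eu₀w₀))) A≡0))
                                 B C A≡BC
          no-smaller (suc (suc _)) (s≤s (s≤s ()))

  rank-two⇒complete-with-trivial-gains :
    Connected Γ → Bipartite Γ → IsRank A 2 → CompleteBipartite Γ × All4CyclesGainOne Γ
  rank-two⇒complete-with-trivial-gains connected (col , bip) (rank≤2 , minimal) =
    (col , proj₁ colours , proj₂ colours , λ u v → bip u v , connected⇒complete connected) ,
    λ { a b c d (_ , _ , _ , _ , _ , _ , eab , ebc , ecd , eda) → 4-cycle-gain eab ebc ecd eda }
    where
    open Colouring col bip
    open RankAtMostTwo rank≤2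
    colours : (∃ λ x → col x ≡ true) × (∃ λ x → col x ≡ false)
    colours = both-colours (proj₂ (proj₂ (nonzero⇒edge (minimal 0 (s≤s z≤n)))))

  complete-with-trivial-gains⇒rank-two : CompleteBipartite Γ × All4CyclesGainOne Γ → IsRank A 2
  complete-with-trivial-gains⇒rank-two ((col , (u₀ , cu₀) , (w₀ , cw₀) , edges) , gains) =
    CompleteWithTrivialGains.rank-two (λ u v → proj₂ (edges u v)) gains cu₀ cw₀
    where open Colouring col (λ u v → proj₁ (edges u v))

lemma5 : (ℝ : Reals) → let open Quaternions ℝ in
    ∀ (n : ℕ) (Γ : GainGraph n) → Connected Γ → Bipartite Γ →
    (IsRank (adjMatrix Γ) 2 ⇔ (CompleteBipartite Γ × All4CyclesGainOne Γ))
lemma5 ℝ n Γ connected bipartite =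
  mk⇔ (rank-two⇒complete-with-trivial-gains connected bipartite) complete-with-trivial-gains⇒rank-two
  where open GainGraphRank ℝ Γ
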